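{- Let $D$ be the set of Dyck numbers and for $n\ge1$ let $E_n=\{t\in D:\ 2^{n-1}\le t\le 2^n-1\}$ (the Dyck numbers with binary length exactly $n$). For every odd $n\ge 5$, $$E_n=\bigl(E_{n-1}+2^{n-2}\bigr)\ \cup\ \bigl(E_{n-1}+2^{n-1}\bigr),$$ where every element of $E_{n-1}+2^{n-2}$ is smaller than every element of $E_{n-1}+2^{n-1}$; that is, listing $E_n$ in increasing order gives the increasing list of $E_{n-1}$ shifted by $2^{n-2}$ followed by the increasing list of $E_{n-1}$ shifted by $2^{n-1}$.
   Context: A Dyck number is a nonnegative integer $t$ such that every suffix of the binary representation of $t$ (i.e. every block of least significant bits) contains at least as many 1's as 0's; these form OEIS A036991: $0,1,3,5,7,11,13,15,19,21,\dots$. For a set $S$ of integers and an integer $c$, $S+c=\{s+c: s\in S\}$. -}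

module Defs where

open import Data.Nat using (ℕ; zero; suc; _+_; _≤_; _^_)
open import Data.Nat.DivMod using (_/_; _%_)
open import Data.List using (List; []; _∷_; length; take)
open import Data.Product using (_×_)

-- Binary digits of t, least significant bit first, no leading zeros
-- (so 0 has the empty representation). Fuel t suffices since t halves.
bitsF : ℕ → ℕ → List ℕ
bitsF zero    t       = []
bitsF (suc f) zero    = []
bitsF (suc f) (suc t) = (suc t % 2) ∷ bitsF f (suc t / 2)

bits : ℕ → List ℕ
bits t = bitsF t t

count1 : List ℕ → ℕ
count1 []           = 0
count1 (zero ∷ bs)  = count1 bs
count1 (suc _ ∷ bs) = suc (count1 bs)

count0 : List ℕ → ℕ
count0 []           = 0
count0 (zero ∷ bs)  = suc (count0 bs)
count0 (suc _ ∷ bs) = count0 bs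

IsDyck : ℕ → Set
IsDyck t = ∀ k → k ≤ length (bits t) → count0 (take k (bits t)) ≤ count1 (take k (bits t))

InE : ℕ → ℕ → Set
InE n t = IsDyck t × (2 ^ (n Data.Nat.∸ 1) ≤ t) × (t Data.Nat.< 2 ^ n)

-- Reading binary digits least significant first, an element t of E (m + 2) is
-- r + q·2^m with r < 2^m and q ∈ {2, 3}, whose digit list is bin m r followed by
-- 0 1 or by 1 1, while s ∈ E (m + 1) is r + 2^m with digit list bin m r followed
-- by 1. Appending 1 1 keeps the Dyck property exactly when appending 1 does. So
-- does appending 0 1 when m is odd: then the odd-length prefix bin m r has strictly
-- more 1's than 0's, which leaves room for the 0.
module Submission where

open import Defs
open import Data.Nat using (ℕ; zero; suc; _+_; _*_; _∸_; _^_; _≤_; _<_; _≤?_; z≤n; s≤s; NonZero)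
open import Data.Nat.Properties
open import Data.Nat.DivMod using (_%_; _/_; m≡m%n+[m/n]*n; m%n<n; m*n/n≡m; /-monoˡ-≤; m<n*o⇒m/o<n; m/n<m; [m+n]%n≡m%n; [m+kn]%n≡m%n; m*n%n≡0; +-distrib-/-∣ʳ)
open import Data.Nat.Divisibility using (divides-refl)
open import Data.Nat.Tactic.RingSolver using (solve-∀)
open import Data.List using (List; []; _∷_; _++_; _∷ʳ_; length; take)
open import Data.List.Properties using (++-assoc; length-++; take-all)
open import Data.Product using (_×_; _,_; proj₁; proj₂; Σ; ∃-syntax)
open import Data.Sum using (_⊎_; inj₁; inj₂)
open import Function.Bundles using (_⇔_; mk⇔; Equivalence)
open import Relation.Nullary using (yes; no; contradiction)
open import Relation.Binary.PropositionalEquality using (_≡_; refl; sym; trans; cong; cong₂; subst; subst₂; module ≡-Reasoning)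

open Equivalence using (to; from)

Balanced : List ℕ → Set
Balanced L = count0 L ≤ count1 L

-- IsDyck t is definitionally Dyck (bits t).
Dyck : List ℕ → Set
Dyck L = ∀ k → k ≤ length L → Balanced (take k L)

count0-++ : ∀ L M → count0 (L ++ M) ≡ count0 L + count0 M
count0-++ []          M = refl
count0-++ (zero ∷ L)  M = cong suc (count0-++ L M)
count0-++ (suc _ ∷ L) M = count0-++ L M

count1-++ : ∀ L M → count1 (L ++ M) ≡ count1 L + count1 M
count1-++ []          M = refl
count1-++ (zero ∷ L)  M = count1-++ L M
count1-++ (suc _ ∷ L) M = cong suc (count1-++ L M)

count0+count1≡length : ∀ L → count0 L + count1 L ≡ length L
count0+count1≡length []          = refl
count0+count1≡length (zero ∷ L)  = cong suc (count0+count1≡length L)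
count0+count1≡length (suc _ ∷ L) = trans (+-suc (count0 L) (count1 L)) (cong suc (count0+count1≡length L))

Balanced-++ : ∀ L M → count0 L + count0 M ≤ count1 L + count1 M → Balanced (L ++ M)
Balanced-++ L M = subst₂ _≤_ (sym (count0-++ L M)) (sym (count1-++ L M))

Balanced-∷ʳ1 : ∀ L → Balanced L → Balanced (L ∷ʳ 1)
Balanced-∷ʳ1 L bal = Balanced-++ L (1 ∷ []) (+-mono-≤ bal z≤n)

Balanced-∷ʳ0 : ∀ L → length L % 2 ≡ 1 → Balanced L → Balanced (L ∷ʳ 0)
Balanced-∷ʳ0 L odd bal with m≤n⇒m<n∨m≡n bal
... | inj₁ c0<c1 = Balanced-++ L (0 ∷ []) (subst₂ _≤_ (+-comm 1 (count0 L)) (sym (+-identityʳ _)) c0<c1)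
... | inj₂ c0≡c1 = contradiction (trans (sym even) odd) λ ()
  where
  even : length L % 2 ≡ 0
  even = begin
    length L % 2                ≡⟨ cong (_% 2) (sym (count0+count1≡length L)) ⟩
    (count0 L + count1 L) % 2   ≡⟨ cong (λ c → (c + count1 L) % 2) c0≡c1 ⟩
    (count1 L + count1 L) % 2   ≡⟨ cong (_% 2) (sym (trans (*-comm (count1 L) 2) (cong (count1 L +_) (+-identityʳ _)))) ⟩
    (count1 L * 2) % 2          ≡⟨ m*n%n≡0 (count1 L) 2 ⟩
    0                           ∎
    where open ≡-Reasoning

take-++ˡ : ∀ {A : Set} k (L M : List A) → k ≤ length L → take k (L ++ M) ≡ take k L
take-++ˡ zero    L       M _         = refl
take-++ˡ (suc k) (x ∷ L) M (s≤s k≤L) = cong (x ∷_) (take-++ˡ k L M k≤L)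

Dyck⇒Balanced : ∀ L → Dyck L → Balanced L
Dyck⇒Balanced L dyck = subst Balanced (take-all (length L) L ≤-refl) (dyck (length L) ≤-refl)

Dyck-++⁻ˡ : ∀ L M → Dyck (L ++ M) → Dyck L
Dyck-++⁻ˡ L M dyck k k≤L =
  subst Balanced (take-++ˡ k L M k≤L) (dyck k (≤-trans k≤L (≤-trans (m≤m+n _ _) (≤-reflexive (sym (length-++ L))))))

Dyck-∷ʳ⁺ : ∀ L x → Dyck L → Balanced (L ∷ʳ x) → Dyck (L ∷ʳ x)
Dyck-∷ʳ⁺ L x dyck bal k k≤ with k ≤? length L
... | yes k≤L = subst Balanced (sym (take-++ˡ k L _ k≤L)) (dyck k k≤L)
... | no  k≰L = subst Balanced (sym (take-all k (L ∷ʳ x) L∷ʳx≤k)) bal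
  where
  L∷ʳx≤k : length (L ∷ʳ x) ≤ k
  L∷ʳx≤k = subst (_≤ k) (sym (trans (length-++ L) (+-comm (length L) 1))) (≰⇒> k≰L)

Dyck-∷ʳ1 : ∀ L → Dyck L → Dyck (L ∷ʳ 1)
Dyck-∷ʳ1 L dyck = Dyck-∷ʳ⁺ L 1 dyck (Balanced-∷ʳ1 L (Dyck⇒Balanced L dyck))

Dyck-∷ʳ0 : ∀ L → length L % 2 ≡ 1 → Dyck L → Dyck (L ∷ʳ 0)
Dyck-∷ʳ0 L odd dyck = Dyck-∷ʳ⁺ L 0 dyck (Balanced-∷ʳ0 L odd (Dyck⇒Balanced L dyck))

Dyck[L++01]⇔Dyck[L++1] : ∀ L → length L % 2 ≡ 1 → Dyck (L ++ 0 ∷ 1 ∷ []) ⇔ Dyck (L ++ 1 ∷ [])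
Dyck[L++01]⇔Dyck[L++1] L odd = mk⇔
  (λ dyck → Dyck-∷ʳ1 L (Dyck-++⁻ˡ L _ dyck))
  (λ dyck → subst Dyck (++-assoc L (0 ∷ []) (1 ∷ [])) (Dyck-∷ʳ1 (L ∷ʳ 0) (Dyck-∷ʳ0 L odd (Dyck-++⁻ˡ L _ dyck))))

Dyck[L++11]⇔Dyck[L++1] : ∀ L → Dyck (L ++ 1 ∷ 1 ∷ []) ⇔ Dyck (L ++ 1 ∷ [])
Dyck[L++11]⇔Dyck[L++1] L = mk⇔
  (λ dyck → Dyck-++⁻ˡ (L ∷ʳ 1) (1 ∷ []) (subst Dyck (sym (++-assoc L (1 ∷ []) (1 ∷ []))) dyck))
  (λ dyck → subst Dyck (++-assoc L (1 ∷ []) (1 ∷ [])) (Dyck-∷ʳ1 (L ∷ʳ 1) dyck))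

-- Unlike bits, exactly m digits: leading zeros are kept.
bin : ℕ → ℕ → List ℕ
bin zero    r = []
bin (suc m) r = r % 2 ∷ bin m (r / 2)

length-bin : ∀ m r → length (bin m r) ≡ m
length-bin zero    r = refl
length-bin (suc m) r = cong suc (length-bin m (r / 2))

[1+t]/2≤t : ∀ t → suc t / 2 ≤ t
[1+t]/2≤t t = ≤-pred (m/n<m (suc t) 2 (s≤s (s≤s z≤n)))

bitsF-0 : ∀ f → bitsF f 0 ≡ []
bitsF-0 zero    = refl
bitsF-0 (suc f) = refl

bitsF-fuel : ∀ f g t → t ≤ f → t ≤ g → bitsF f t ≡ bitsF g t
bitsF-fuel f       g       zero    _         _         = trans (bitsF-0 f) (sym (bitsF-0 g))
bitsF-fuel (suc f) (suc g) (suc t) (s≤s t≤f) (s≤s t≤g) =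
  cong (suc t % 2 ∷_) (bitsF-fuel f g (suc t / 2) (≤-trans ([1+t]/2≤t t) t≤f) (≤-trans ([1+t]/2≤t t) t≤g))

bits-unfold : ∀ {t} → 0 < t → bits t ≡ t % 2 ∷ bits (t / 2)
bits-unfold {suc t} _ = cong (suc t % 2 ∷_) (bitsF-fuel t (suc t / 2) (suc t / 2) ([1+t]/2≤t t) ≤-refl)

bits-+-* : ∀ m r q → r < 2 ^ m → bits (r + suc q * 2 ^ m) ≡ bin m r ++ bits (suc q)
bits-+-* zero    zero    q _    = cong bits (*-identityʳ (suc q))
bits-+-* zero    (suc r) q (s≤s ())
bits-+-* (suc m) r       q r<2p = begin
  bits t                                ≡⟨ bits-unfold 0<t ⟩
  t % 2 ∷ bits (t / 2)                  ≡⟨ cong₂ (λ d u → d ∷ bits u) t%2≡r%2 t/2≡r/2+Q ⟩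
  r % 2 ∷ bits (r / 2 + Q)              ≡⟨ cong (r % 2 ∷_) (bits-+-* m (r / 2) q r/2<p) ⟩
  r % 2 ∷ bin m (r / 2) ++ bits (suc q) ∎
  where
  open ≡-Reasoning
  Q t : ℕ
  Q = suc q * 2 ^ m
  t = r + suc q * 2 ^ suc m
  t≡r+Q*2 : t ≡ r + Q * 2
  t≡r+Q*2 = cong (r +_) (trans (cong (suc q *_) (*-comm 2 (2 ^ m))) (sym (*-assoc (suc q) (2 ^ m) 2)))
  t%2≡r%2 : t % 2 ≡ r % 2
  t%2≡r%2 = trans (cong (_% 2) t≡r+Q*2) ([m+kn]%n≡m%n r Q 2)
  t/2≡r/2+Q : t / 2 ≡ r / 2 + Q
  t/2≡r/2+Q = trans (cong (_/ 2) t≡r+Q*2) (trans (+-distrib-/-∣ʳ r (divides-refl Q)) (cong (r / 2 +_) (m*n/n≡m Q 2)))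
  r/2<p : r / 2 < 2 ^ m
  r/2<p = m<n*o⇒m/o<n (subst (r <_) (*-comm 2 (2 ^ m)) r<2p)
  0<t : 0 < t
  0<t = <-≤-trans (m^n>0 2 (suc m)) (≤-trans (m≤m+n _ _) (m≤n+m _ r))

IsDyck[r+2*2^m]⇔IsDyck[r+1*2^m] : ∀ m r → m % 2 ≡ 1 → r < 2 ^ m → IsDyck (r + 2 * 2 ^ m) ⇔ IsDyck (r + 1 * 2 ^ m)
IsDyck[r+2*2^m]⇔IsDyck[r+1*2^m] m r odd r<2^m =
  subst₂ (λ L M → Dyck L ⇔ Dyck M) (sym (bits-+-* m r 1 r<2^m)) (sym (bits-+-* m r 0 r<2^m))
    (Dyck[L++01]⇔Dyck[L++1] (bin m r) (trans (cong (_% 2) (length-bin m r)) odd))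

IsDyck[r+3*2^m]⇔IsDyck[r+1*2^m] : ∀ m r → r < 2 ^ m → IsDyck (r + 3 * 2 ^ m) ⇔ IsDyck (r + 1 * 2 ^ m)
IsDyck[r+3*2^m]⇔IsDyck[r+1*2^m] m r r<2^m =
  subst₂ (λ L M → Dyck L ⇔ Dyck M) (sym (bits-+-* m r 2 r<2^m)) (sym (bits-+-* m r 0 r<2^m))
    (Dyck[L++11]⇔Dyck[L++1] (bin m r))

divMod-within : ∀ d .{{_ : NonZero d}} a b t → a * d ≤ t → t < b * d →
                ∃[ r ] ∃[ q ] r < d × a ≤ q × q < b × t ≡ r + q * d
divMod-within d a b t ad≤t t<bd =
  t % d , t / d , m%n<n t d , ≤-trans (≤-reflexive (sym (m*n/n≡m a d))) (/-monoˡ-≤ d ad≤t) ,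
  m<n*o⇒m/o<n t<bd , m≡m%n+[m/n]*n t d

within-block : ∀ {d r} q → r < d → q * d ≤ r + q * d × r + q * d < suc q * d
within-block {d} {r} q r<d = m≤n+m (q * d) r , +-monoˡ-< (q * d) r<d

r+2p≡[r+p]+p : ∀ r p → r + 2 * p ≡ (r + 1 * p) + p
r+2p≡[r+p]+p = solve-∀

r+3p≡[r+p]+2p : ∀ r p → r + 3 * p ≡ (r + 1 * p) + 2 * p
r+3p≡[r+p]+2p = solve-∀

module _ (m : ℕ) where

  private
    p : ℕ
    p = 2 ^ m
    instance
      p≢0 : NonZero p
      p≢0 = m^n≢0 2 m

  InE-1+m⁺ : ∀ {r} → r < p → IsDyck (r + 1 * p) → InE (1 + m) (r + 1 * p)
  InE-1+m⁺ r<p dyck = dyck , ≤-trans (m≤m+n p 0) (proj₁ (within-block 1 r<p)) , proj₂ (within-block 1 r<p)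

  InE-2+m⁺ : ∀ {r q} → r < p → 2 ≤ q → q < 4 → IsDyck (r + q * p) → InE (2 + m) (r + q * p)
  InE-2+m⁺ {r} {q} r<p 2≤q q<4 dyck =
    dyck , ≤-trans (*-monoˡ-≤ p 2≤q) (proj₁ (within-block q r<p)) ,
    subst (r + q * p <_) (*-assoc 2 2 p) (<-≤-trans (proj₂ (within-block q r<p)) (*-monoˡ-≤ p q<4))

  module _ (m-odd : m % 2 ≡ 1) where

    InE-2+m⇒shifted : ∀ t → InE (2 + m) t → Σ ℕ λ s → InE (1 + m) s × (t ≡ s + p ⊎ t ≡ s + 2 * p)
    InE-2+m⇒shifted t (dyck , 2p≤t , t<4p) with divMod-within p 2 4 t 2p≤t (subst (t <_) (sym (*-assoc 2 2 p)) t<4p)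
    ... | r , 2 , r<p , _ , _ , refl =
      r + 1 * p , InE-1+m⁺ r<p (to (IsDyck[r+2*2^m]⇔IsDyck[r+1*2^m] m r m-odd r<p) dyck) , inj₁ (r+2p≡[r+p]+p r p)
    ... | r , 3 , r<p , _ , _ , refl =
      r + 1 * p , InE-1+m⁺ r<p (to (IsDyck[r+3*2^m]⇔IsDyck[r+1*2^m] m r r<p) dyck) , inj₂ (r+3p≡[r+p]+2p r p)
    ... | _ , 0 , _ , () , _
    ... | _ , 1 , _ , s≤s () , _
    ... | _ , suc (suc (suc (suc _))) , _ , _ , s≤s (s≤s (s≤s (s≤s ()))) , _

    shifted⇒InE-2+m : ∀ t → (Σ ℕ λ s → InE (1 + m) s × (t ≡ s + p ⊎ t ≡ s + 2 * p)) → InE (2 + m) t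
    shifted⇒InE-2+m t (s , (dyck , p≤s , s<2p) , t≡s+) with divMod-within p 1 2 s (subst (_≤ s) (sym (*-identityˡ p)) p≤s) s<2p | t≡s+
    ... | r , 1 , r<p , _ , _ , refl | inj₁ refl =
      subst (InE (2 + m)) (r+2p≡[r+p]+p r p)
        (InE-2+m⁺ r<p ≤-refl (n≤1+n 3) (from (IsDyck[r+2*2^m]⇔IsDyck[r+1*2^m] m r m-odd r<p) dyck))
    ... | r , 1 , r<p , _ , _ , refl | inj₂ refl =
      subst (InE (2 + m)) (r+3p≡[r+p]+2p r p)
        (InE-2+m⁺ r<p (n≤1+n 2) ≤-refl (from (IsDyck[r+3*2^m]⇔IsDyck[r+1*2^m] m r r<p) dyck))
    ... | _ , 0 , _ , () , _ | _
    ... | _ , suc (suc _) , _ , _ , s≤s (s≤s ()) , _ | _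

  InE-1+m-shifts-ordered : ∀ s s′ → InE (1 + m) s → InE (1 + m) s′ → s + p < s′ + 2 * p
  InE-1+m-shifts-ordered s s′ (_ , _ , s<2p) (_ , p≤s′ , _) =
    subst (s + p <_) (+-comm (2 * p) s′) (+-mono-<-≤ s<2p p≤s′)

proposition7 : (n : ℕ) → n % 2 ≡ 1 → 5 ≤ n →
    ((t : ℕ) → InE n t ⇔ (Σ ℕ λ s → InE (n ∸ 1) s × ((t ≡ s + 2 ^ (n ∸ 2)) ⊎ (t ≡ s + 2 ^ (n ∸ 1)))))
    × ((s s′ : ℕ) → InE (n ∸ 1) s → InE (n ∸ 1) s′ → s + 2 ^ (n ∸ 2) < s′ + 2 ^ (n ∸ 1))
proposition7 (suc (suc m)) n-odd (s≤s (s≤s _)) =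
  (λ t → mk⇔ (InE-2+m⇒shifted m m-odd t) (shifted⇒InE-2+m m m-odd t)) , InE-1+m-shifts-ordered m
  where
  m-odd : m % 2 ≡ 1
  m-odd = trans (sym ([m+n]%n≡m%n m 2)) (trans (cong (_% 2) (+-comm m 2)) n-odd)
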